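{- Let $k\ge 2$ and let $A=\{a_1,\dots,a_k\}$ be positive integers with $\gcd(a_1,\dots,a_k)=1$. For $1\le i\le a_1-1$ let $m_i$ be the least positive integer with $m_i\equiv i\pmod{a_1}$ and $m_i\in{\rm R}(A)$, and set $m_0=0$. If $\lambda$ is a complex number with $\lambda\ne 0$ and $\lambda^{a_1}\ne 1$, then \begin{align*} \sum_{n\in{\rm NR}(A)}\lambda^n n^2&=\frac{1}{\lambda^{a_1}-1}\sum_{i=0}^{a_1-1}m_i^2\lambda^{m_i}-\frac{2 a_1\lambda^{a_1}}{(\lambda^{a_1}-1)^2}\sum_{i=0}^{a_1-1}m_i\lambda^{m_i}\\ &\quad+\frac{a_1^2\lambda^{a_1}(\lambda^{a_1}+1)}{(\lambda^{a_1}-1)^3}\sum_{i=0}^{a_1-1}\lambda^{m_i} -\frac{\lambda(\lambda+1)}{(\lambda-1)^3}. \end{align*}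
   Context: ${\rm R}(A)$ denotes the set of positive integers that can be written as $x_1a_1+\dots+x_ka_k$ with nonnegative integers $x_i$, and ${\rm NR}(A)$ denotes the (finite) set of positive integers not in ${\rm R}(A)$. -}

module Defs where

open import Level using (Level)
open import Data.Nat using (ℕ; zero; suc; _<_; _≤_)
open import Data.Nat as ℕ using ()
open import Data.Nat.GCD using (gcd)
open import Data.Fin as Fin using (Fin)
open import Data.List using (List; []; _∷_)
open import Data.Product using (∃; _×_)
open import Relation.Binary.PropositionalEquality using (_≡_)
open import Relation.Nullary using (¬_)
open import Algebra.Bundles using (CommutativeRing)

∑ℕ : (k : ℕ) → (Fin k → ℕ) → ℕ
∑ℕ zero    f = 0
∑ℕ (suc k) f = f Fin.zero ℕ.+ ∑ℕ k (λ i → f (Fin.suc i))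

-- gcd of a_1,...,a_k (gcd of the empty family is 0)
gcdAll : (k : ℕ) → (Fin k → ℕ) → ℕ
gcdAll zero    a = 0
gcdAll (suc k) a = gcd (a Fin.zero) (gcdAll k (λ i → a (Fin.suc i)))

InR : (k : ℕ) → (Fin k → ℕ) → ℕ → Set
InR k a n = 0 < n × ∃ λ (x : Fin k → ℕ) → n ≡ ∑ℕ k (λ i → x i ℕ.* a i)

InNR : (k : ℕ) → (Fin k → ℕ) → ℕ → Set
InNR k a n = 0 < n × ¬ InR k a n

CongMod : ℕ → ℕ → ℕ → Set
CongMod n i a = ∃ λ q → n ≡ i ℕ.+ q ℕ.* a

module RingOps {c ℓ : Level} (R : CommutativeRing c ℓ) where
  open CommutativeRing R using (Carrier; _≈_; _+_; _*_; 0#; 1#)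

  ι : ℕ → Carrier
  ι zero    = 0#
  ι (suc n) = 1# + ι n

  pow : Carrier → ℕ → Carrier
  pow x zero    = 1#
  pow x (suc n) = x * pow x n

  ∑< : ℕ → (ℕ → Carrier) → Carrier
  ∑< zero    f = 0#
  ∑< (suc n) f = ∑< n f + f n

  ∑L : List ℕ → (ℕ → Carrier) → Carrier
  ∑L []       f = 0#
  ∑L (x ∷ xs) f = f x + ∑L xs f

  IsField : Set (c Level.⊔ ℓ)
  IsField = ¬ (1# ≈ 0#) × (∀ x → ¬ (x ≈ 0#) → ∃ λ y → x * y ≈ 1#)

  CharZero : Set ℓ
  CharZero = ∀ n → ¬ (ι (suc n) ≈ 0#)

-- A positive n with residue i modulo a₁ is a gap exactly when i ≠ 0 and n < mᵢ, so NR(A) is the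
-- disjoint union of the progressions i, i + a₁, …, mᵢ − a₁ for 1 ≤ i < a₁. With u = (λ^a₁ − 1)⁻¹,
--   F(n) = u n²λⁿ − 2a₁λ^a₁u² nλⁿ + a₁²λ^a₁(λ^a₁ + 1)u³ λⁿ
-- satisfies F(n + a₁) − F(n) = λⁿn², so the sum over the i-th progression telescopes to F(mᵢ) − F(i).
-- Summing over i gives the first three terms of the formula, and ∑_{i<a₁} F(i) = λ(λ + 1)/(λ − 1)³
-- follows from the closed forms of ∑_{i<n} iʲλⁱ for j ≤ 2.

{-# OPTIONS --safe #-}
module Submission where

open import Defs
open import Algebra.Bundles using (CommutativeRing)
open import Data.Empty using (⊥-elim)
open import Data.Fin as Fin using (Fin)
open import Data.List using (List; []; _∷_)
open import Data.List.Membership.Propositional using (_∈_)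
open import Data.List.Relation.Unary.All as All using ()
open import Data.List.Relation.Unary.AllPairs using (_∷_)
open import Data.List.Relation.Unary.Any using (here; there)
open import Data.List.Relation.Unary.Unique.Propositional using (Unique)
open import Data.Nat using (ℕ; _<_; _≤_; s≤s; z≤n)
open import Data.Nat as ℕ using (zero; suc; NonZero)
open import Data.Nat.Properties using (≤-trans)
import Data.Nat.Properties as ℕ
open import Data.List.Membership.DecPropositional ℕ._≟_ using (_∈?_)
open import Data.Nat.DivMod using (_%_; _/_; m≡m%n+[m/n]*n; m%n<n)
open import Data.Nat.Tactic.RingSolver using (solve-∀)
open import Data.Product using (∃; _×_; _,_; proj₁; proj₂)
open import Data.Sum using (inj₁; inj₂)
open import Function.Base using (_∘_)
open import Function.Bundles using (_⇔_; mk⇔; Equivalence)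
import Function.Properties.Equivalence as ⇔
open import Relation.Binary.PropositionalEquality as ≡ using (_≡_)
open import Relation.Nullary using (Dec; yes; no; ¬_)

-- The ring solver needs coefficients with decidable equality; ℤ maps into every commutative ring.
module IntegerCoefficientSolver {c ℓ} (R : CommutativeRing c ℓ) where

  import Algebra.Solver.Ring.AlmostCommutativeRing as ACR
  open import Data.Integer as ℤ using (ℤ; +_; -[1+_]; _⊖_)
  import Data.Integer.Properties as ℤ
  open import Data.Maybe using (Maybe; just; nothing)
  open import Data.Sign as Sign using (Sign)

  open CommutativeRing R
  open import Algebra.Properties.Ring ring using (-‿distribˡ-*; -‿distribʳ-*)
  open import Algebra.Properties.AbelianGroup +-abelianGroup
    using (ε⁻¹≈ε; ⁻¹-involutive; ⁻¹-∙-comm; ⁻¹-anti-homo‿-; //-rightDividesʳ)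
  open import Algebra.Properties.Semiring.Mult.TCOptimised semiring using (×-homo-+; ×1-homo-*)
    renaming (_×_ to _×′_)
  open import Relation.Binary.Reasoning.Setoid setoid

  private

    infixr 8 _·_

    _·_ : Sign → Carrier → Carrier
    Sign.+ · x = x
    Sign.- · x = - x

    ⟦_⟧ : ℤ → Carrier
    ⟦ i ⟧ = ℤ.sign i · (ℤ.∣ i ∣ ×′ 1#)

    ·-cong : ∀ s {x y} → x ≈ y → s · x ≈ s · y
    ·-cong Sign.+ x≈y = x≈y
    ·-cong Sign.- x≈y = -‿cong x≈y

    ·-* : ∀ s t x y → (s Sign.* t) · (x * y) ≈ s · x * t · y
    ·-* Sign.+ Sign.+ x y = refl
    ·-* Sign.+ Sign.- x y = -‿distribʳ-* x y
    ·-* Sign.- Sign.+ x y = -‿distribˡ-* x y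
    ·-* Sign.- Sign.- x y = begin
      x * y        ≈⟨ ⁻¹-involutive (x * y) ⟨
      - - (x * y)  ≈⟨ -‿cong (-‿distribˡ-* x y) ⟩
      - (- x * y)  ≈⟨ -‿distribʳ-* (- x) y ⟩
      - x * - y    ∎

    ◃-homo : ∀ s n → ⟦ s ℤ.◃ n ⟧ ≈ s · (n ×′ 1#)
    ◃-homo Sign.+ zero    = refl
    ◃-homo Sign.- zero    = sym ε⁻¹≈ε
    ◃-homo Sign.+ (suc n) = refl
    ◃-homo Sign.- (suc n) = refl

    *-homo : ∀ i j → ⟦ i ℤ.* j ⟧ ≈ ⟦ i ⟧ * ⟦ j ⟧
    *-homo i j = begin
      ⟦ (s Sign.* t) ℤ.◃ (m ℕ.* n) ⟧      ≈⟨ ◃-homo (s Sign.* t) (m ℕ.* n) ⟩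
      (s Sign.* t) · ((m ℕ.* n) ×′ 1#)    ≈⟨ ·-cong (s Sign.* t) (×1-homo-* m n) ⟩
      (s Sign.* t) · (m ×′ 1# * n ×′ 1#)  ≈⟨ ·-* s t _ _ ⟩
      ⟦ i ⟧ * ⟦ j ⟧                       ∎
      where s = ℤ.sign i; t = ℤ.sign j; m = ℤ.∣ i ∣; n = ℤ.∣ j ∣

    -‿homo : ∀ i → ⟦ ℤ.- i ⟧ ≈ - ⟦ i ⟧
    -‿homo (+ zero)  = sym ε⁻¹≈ε
    -‿homo (+ suc n) = refl
    -‿homo -[1+ n ]  = sym (⁻¹-involutive _)

    ⊖-homo-≥ : ∀ {m n} → n ℕ.≤ m → ⟦ m ⊖ n ⟧ ≈ m ×′ 1# - n ×′ 1#
    ⊖-homo-≥ {m} {n} n≤m = begin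
      ⟦ m ⊖ n ⟧                                ≡⟨ ≡.cong ⟦_⟧ (ℤ.⊖-≥ n≤m) ⟩
      (m ℕ.∸ n) ×′ 1#                          ≈⟨ //-rightDividesʳ (n ×′ 1#) _ ⟨
      ((m ℕ.∸ n) ×′ 1# + n ×′ 1#) - n ×′ 1#    ≈⟨ +-congʳ (×-homo-+ 1# (m ℕ.∸ n) n) ⟨
      (m ℕ.∸ n ℕ.+ n) ×′ 1# - n ×′ 1#          ≡⟨ ≡.cong (λ k → k ×′ 1# - n ×′ 1#) (ℕ.m∸n+n≡m n≤m) ⟩
      m ×′ 1# - n ×′ 1#                        ∎

    ⊖-homo : ∀ m n → ⟦ m ⊖ n ⟧ ≈ m ×′ 1# - n ×′ 1#
    ⊖-homo m n with n ℕ.≤? m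
    ... | yes n≤m = ⊖-homo-≥ n≤m
    ... | no  n≰m = begin
      ⟦ m ⊖ n ⟧              ≡⟨ ≡.cong ⟦_⟧ (ℤ.⊖-swap m n) ⟩
      ⟦ ℤ.- (n ⊖ m) ⟧        ≈⟨ -‿homo (n ⊖ m) ⟩
      - ⟦ n ⊖ m ⟧            ≈⟨ -‿cong (⊖-homo-≥ (ℕ.<⇒≤ (ℕ.≰⇒> n≰m))) ⟩
      - (n ×′ 1# - m ×′ 1#)  ≈⟨ ⁻¹-anti-homo‿- (n ×′ 1#) (m ×′ 1#) ⟩
      m ×′ 1# - n ×′ 1#      ∎

    +-homo : ∀ i j → ⟦ i ℤ.+ j ⟧ ≈ ⟦ i ⟧ + ⟦ j ⟧
    +-homo (+ m)    (+ n)    = ×-homo-+ 1# m n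
    +-homo (+ m)    -[1+ n ] = ⊖-homo m (suc n)
    +-homo -[1+ m ] (+ n)    = trans (⊖-homo n (suc m)) (+-comm _ _)
    +-homo -[1+ m ] -[1+ n ] = begin
      - (suc (suc (m ℕ.+ n)) ×′ 1#)      ≡⟨ ≡.cong (λ k → - (suc k ×′ 1#)) (ℕ.+-suc m n) ⟨
      - ((suc m ℕ.+ suc n) ×′ 1#)        ≈⟨ -‿cong (×-homo-+ 1# (suc m) (suc n)) ⟩
      - (suc m ×′ 1# + suc n ×′ 1#)      ≈⟨ ⁻¹-∙-comm _ _ ⟨
      - (suc m ×′ 1#) + - (suc n ×′ 1#)  ∎

    homomorphism : ℤ.+-*-rawRing ACR.-Raw-AlmostCommutative⟶ ACR.fromCommutativeRing R
    homomorphism = record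
      { ⟦_⟧ = ⟦_⟧ ; +-homo = +-homo ; *-homo = *-homo ; -‿homo = -‿homo ; 0-homo = refl ; 1-homo = refl }

    ⟦⟧-≟ : ∀ i j → Maybe (⟦ i ⟧ ≈ ⟦ j ⟧)
    ⟦⟧-≟ i j with i ℤ.≟ j
    ... | yes ≡.refl = just refl
    ... | no  _      = nothing

  open import Algebra.Solver.Ring ℤ.+-*-rawRing (ACR.fromCommutativeRing R) homomorphism ⟦⟧-≟ public
    using (solve; _:=_; _:+_; _:*_; _:-_; con)

module RingOpsProperties {c ℓ} (R : CommutativeRing c ℓ) where

  open import Data.Integer using (+_)

  open CommutativeRing R
  open RingOps R
  open IntegerCoefficientSolver R using (solve; _:=_; _:+_; _:*_; _:-_; con)
  open import Relation.Binary.Reasoning.Setoid setoid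

  ι-+ : ∀ m n → ι (m ℕ.+ n) ≈ ι m + ι n
  ι-+ zero    n = sym (+-identityˡ _)
  ι-+ (suc m) n = trans (+-congˡ (ι-+ m n)) (sym (+-assoc _ _ _))

  ι-2 : ι 2 ≈ 1# + 1#
  ι-2 = +-congˡ (+-identityʳ 1#)

  pow-+ : ∀ x m n → pow x (m ℕ.+ n) ≈ pow x m * pow x n
  pow-+ x zero    n = sym (*-identityˡ _)
  pow-+ x (suc m) n = trans (*-congˡ (pow-+ x m n)) (sym (*-assoc _ _ _))

  x≈y+z[v-1]⇒x≈y : ∀ {x y z v} → v ≈ 1# → x ≈ y + z * (v - 1#) → x ≈ y
  x≈y+z[v-1]⇒x≈y {x} {y} {z} {v} v≈1 x≈ = begin
    x                 ≈⟨ x≈ ⟩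
    y + z * (v - 1#)  ≈⟨ +-congˡ (*-congˡ (trans (+-congʳ v≈1) (-‿inverseʳ 1#))) ⟩
    y + z * 0#        ≈⟨ +-congˡ (zeroʳ z) ⟩
    y + 0#            ≈⟨ +-identityʳ y ⟩
    y                 ∎

  inverse-cube : ∀ {u c} → u * c ≈ 1# → ∀ z → (u * u * u) * (z * (c * c * c)) ≈ z
  inverse-cube {u} {c} uc≈1 z = begin
    (u * u * u) * (z * (c * c * c))  ≈⟨ solve 3 (λ u c z → (u :* u :* u) :* (z :* (c :* c :* c))
                                                       := z :* ((u :* c) :* (u :* c) :* (u :* c))) refl u c z ⟩
    z * ((u * c) * (u * c) * (u * c)) ≈⟨ *-congˡ (*-cong (*-cong uc≈1 uc≈1) uc≈1) ⟩
    z * (1# * 1# * 1#)               ≈⟨ solve 1 (λ z → z :* (con (+ 1) :* con (+ 1) :* con (+ 1)) := z) refl z ⟩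
    z                                ∎

module FiniteSums {c ℓ} (R : CommutativeRing c ℓ) where

  open import Data.Integer using (+_)

  open CommutativeRing R
  open RingOps R
  open import Algebra.Properties.AbelianGroup +-abelianGroup using (ε⁻¹≈ε; ⁻¹-∙-comm)
  open IntegerCoefficientSolver R using (solve; _:=_; _:+_; _:-_)
  open import Algebra.Properties.CommutativeSemigroup +-commutativeSemigroup using (interchange)
  open import Relation.Binary.Reasoning.Setoid setoid

  ∑<-cong : ∀ n {f g : ℕ → Carrier} → (∀ i → i < n → f i ≈ g i) → ∑< n f ≈ ∑< n g
  ∑<-cong zero    f≈g = refl
  ∑<-cong (suc n) f≈g = +-cong (∑<-cong n (λ i i<n → f≈g i (ℕ.m<n⇒m<1+n i<n))) (f≈g n ℕ.≤-refl)

  ∑<-zero : ∀ n {f : ℕ → Carrier} → (∀ i → i < n → f i ≈ 0#) → ∑< n f ≈ 0#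
  ∑<-zero n f≈0 = trans (∑<-cong n f≈0) (∑<-0 n)
    where
    ∑<-0 : ∀ n → ∑< n (λ _ → 0#) ≈ 0#
    ∑<-0 zero    = refl
    ∑<-0 (suc n) = trans (+-identityʳ _) (∑<-0 n)

  ∑<-+ : ∀ n (f g : ℕ → Carrier) → ∑< n (λ i → f i + g i) ≈ ∑< n f + ∑< n g
  ∑<-+ zero    f g = sym (+-identityʳ 0#)
  ∑<-+ (suc n) f g = trans (+-congʳ (∑<-+ n f g)) (interchange _ _ _ _)

  ∑<-- : ∀ n (f g : ℕ → Carrier) → ∑< n (λ i → f i - g i) ≈ ∑< n f - ∑< n g
  ∑<-- n f g = begin
    ∑< n (λ i → f i - g i)       ≈⟨ ∑<-+ n f (λ i → - g i) ⟩
    ∑< n f + ∑< n (λ i → - g i)  ≈⟨ +-congˡ (∑<-neg n) ⟩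
    ∑< n f - ∑< n g              ∎
    where
    ∑<-neg : ∀ n → ∑< n (λ i → - g i) ≈ - ∑< n g
    ∑<-neg zero    = sym ε⁻¹≈ε
    ∑<-neg (suc n) = trans (+-congʳ (∑<-neg n)) (⁻¹-∙-comm _ _)

  ∑<-*ʳ : ∀ n (f : ℕ → Carrier) x → ∑< n f * x ≈ ∑< n (λ i → f i * x)
  ∑<-*ʳ zero    f x = zeroˡ x
  ∑<-*ʳ (suc n) f x = trans (distribʳ x _ _) (+-congʳ (∑<-*ʳ n f x))

  ∑<-+ℕ : ∀ m n (f : ℕ → Carrier) → ∑< (m ℕ.+ n) f ≈ ∑< m f + ∑< n (λ j → f (m ℕ.+ j))
  ∑<-+ℕ m zero    f = trans (reflexive (≡.cong (λ k → ∑< k f) (ℕ.+-identityʳ m))) (sym (+-identityʳ _))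
  ∑<-+ℕ m (suc n) f = begin
    ∑< (m ℕ.+ suc n) f                              ≡⟨ ≡.cong (λ k → ∑< k f) (ℕ.+-suc m n) ⟩
    ∑< (m ℕ.+ n) f + f (m ℕ.+ n)                    ≈⟨ +-congʳ (∑<-+ℕ m n f) ⟩
    (∑< m f + ∑< n (λ j → f (m ℕ.+ j))) + f (m ℕ.+ n) ≈⟨ +-assoc _ _ _ ⟩
    ∑< m f + ∑< (suc n) (λ j → f (m ℕ.+ j))         ∎

  ∑<-*ℕ : ∀ k n (f : ℕ → Carrier) → ∑< (k ℕ.* n) f ≈ ∑< k (λ q → ∑< n (λ i → f (q ℕ.* n ℕ.+ i)))
  ∑<-*ℕ zero    n f = refl
  ∑<-*ℕ (suc k) n f = begin
    ∑< (n ℕ.+ k ℕ.* n) f                                 ≡⟨ ≡.cong (λ j → ∑< j f) (ℕ.+-comm n (k ℕ.* n)) ⟩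
    ∑< (k ℕ.* n ℕ.+ n) f                                 ≈⟨ ∑<-+ℕ (k ℕ.* n) n f ⟩
    ∑< (k ℕ.* n) f + ∑< n (λ i → f (k ℕ.* n ℕ.+ i))      ≈⟨ +-congʳ (∑<-*ℕ k n f) ⟩
    ∑< (suc k) (λ q → ∑< n (λ i → f (q ℕ.* n ℕ.+ i)))    ∎

  ∑<-comm : ∀ m n (f : ℕ → ℕ → Carrier) → ∑< m (λ i → ∑< n (f i)) ≈ ∑< n (λ j → ∑< m (λ i → f i j))
  ∑<-comm zero    n f = sym (∑<-zero n (λ _ _ → refl))
  ∑<-comm (suc m) n f = trans (+-congʳ (∑<-comm m n f)) (sym (∑<-+ n _ _))

  ∑<-telescope : (E D : ℕ → Carrier) → (∀ i → E (suc i) - E i ≈ D i) → ∀ n → ∑< n D ≈ E n - E 0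
  ∑<-telescope E D step zero    = sym (-‿inverseʳ (E 0))
  ∑<-telescope E D step (suc n) = begin
    ∑< n D + D n                      ≈⟨ +-cong (∑<-telescope E D step n) (sym (step n)) ⟩
    (E n - E 0) + (E (suc n) - E n)   ≈⟨ solve 3 (λ e e₀ e₁ → (e :- e₀) :+ (e₁ :- e) := e₁ :- e₀) refl (E n) (E 0) (E (suc n)) ⟩
    E (suc n) - E 0                   ∎

  infixr 8 [_]·_

  [_]·_ : {P : Set} → Dec P → Carrier → Carrier
  [ yes _ ]· x = x
  [ no  _ ]· x = 0#

  []·-yes : ∀ {P : Set} {x} → P → (p? : Dec P) → [ p? ]· x ≈ x
  []·-yes p (yes _) = refl
  []·-yes p (no ¬p) = ⊥-elim (¬p p)

  []·-no : ∀ {P : Set} {x} → ¬ P → (p? : Dec P) → [ p? ]· x ≈ 0#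
  []·-no ¬p (yes p) = ⊥-elim (¬p p)
  []·-no ¬p (no _)  = refl

  []·-⇔ : ∀ {P Q : Set} {x} → P ⇔ Q → (p? : Dec P) (q? : Dec Q) → [ p? ]· x ≈ [ q? ]· x
  []·-⇔ P⇔Q (yes p) q? = sym ([]·-yes (Equivalence.to P⇔Q p) q?)
  []·-⇔ P⇔Q (no ¬p) q? = sym ([]·-no (λ q → ¬p (Equivalence.from P⇔Q q)) q?)

  ∑<-[<?]· : ∀ {T K} (f : ℕ → Carrier) → T ≤ K → ∑< K (λ q → [ q ℕ.<? T ]· f q) ≈ ∑< T f
  ∑<-[<?]· {T} {K} f T≤K = begin
    ∑< K g                                     ≡⟨ ≡.cong (λ n → ∑< n g) (ℕ.m+[n∸m]≡n T≤K) ⟨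
    ∑< (T ℕ.+ (K ℕ.∸ T)) g                     ≈⟨ ∑<-+ℕ T (K ℕ.∸ T) g ⟩
    ∑< T g + ∑< (K ℕ.∸ T) (λ j → g (T ℕ.+ j))  ≈⟨ +-cong (∑<-cong T (λ q q<T → []·-yes q<T (q ℕ.<? T)))
                                                         (∑<-zero (K ℕ.∸ T) (λ j _ → []·-no (ℕ.m+n≮m T j) (T ℕ.+ j ℕ.<? T))) ⟩
    ∑< T f + 0#                                ≈⟨ +-identityʳ _ ⟩
    ∑< T f                                     ∎
    where g = λ q → [ q ℕ.<? T ]· f q

  ∑<-[≟]· : ∀ {y B} (f : ℕ → Carrier) → y < B → ∑< B (λ n → [ n ℕ.≟ y ]· f n) ≈ f y
  ∑<-[≟]· {y} {suc B} f y<1+B with y ℕ.≟ B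
  ... | yes ≡.refl = trans (+-cong (∑<-zero B (λ n n<y → []·-no (ℕ.<⇒≢ n<y) (n ℕ.≟ y))) ([]·-yes ≡.refl (y ℕ.≟ y)))
                           (+-identityˡ _)
  ... | no  y≢B    = trans (+-cong (∑<-[≟]· f (ℕ.≤∧≢⇒< (ℕ.≤-pred y<1+B) y≢B)) ([]·-no (y≢B ∘ ≡.sym) (B ℕ.≟ y)))
                           (+-identityʳ _)

  ∑L-as-∑< : ∀ {xs B} (f : ℕ → Carrier) → Unique xs → (∀ x → x ∈ xs → x < B) →
             ∑L xs f ≈ ∑< B (λ n → [ n ∈? xs ]· f n)
  ∑L-as-∑< {[]}     {B} f _ _ = sym (∑<-zero B (λ n _ → []·-no {x = f n} (λ ()) (n ∈? [])))
  ∑L-as-∑< {y ∷ ys} {B} f (y∉ys ∷ uniq) xs<B = begin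
    f y + ∑L ys f                                                   ≈⟨ +-cong (sym (∑<-[≟]· f (xs<B y (here ≡.refl))))
                                                                               (∑L-as-∑< f uniq (λ x x∈ → xs<B x (there x∈))) ⟩
    ∑< B (λ n → [ n ℕ.≟ y ]· f n) + ∑< B (λ n → [ n ∈? ys ]· f n)   ≈⟨ ∑<-+ B _ _ ⟨
    ∑< B (λ n → [ n ℕ.≟ y ]· f n + [ n ∈? ys ]· f n)                ≈⟨ ∑<-cong B (λ n _ → split n (n ℕ.≟ y)) ⟩
    ∑< B (λ n → [ n ∈? y ∷ ys ]· f n)                               ∎
    where
    split : ∀ n (n≟y : Dec (n ≡ y)) → [ n≟y ]· f n + [ n ∈? ys ]· f n ≈ [ n ∈? y ∷ ys ]· f n
    split n (yes ≡.refl) = begin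
      f n + [ n ∈? ys ]· f n  ≈⟨ +-congˡ ([]·-no (λ n∈ys → All.lookup y∉ys n∈ys ≡.refl) (n ∈? ys)) ⟩
      f n + 0#                ≈⟨ +-identityʳ _ ⟩
      f n                     ≈⟨ []·-yes (here ≡.refl) (n ∈? y ∷ ys) ⟨
      [ n ∈? y ∷ ys ]· f n    ∎
    split n (no n≢y) = trans (+-identityˡ _) ([]·-⇔ (mk⇔ there λ { (here n≡y) → ⊥-elim (n≢y n≡y) ; (there n∈) → n∈ })
                                                   (n ∈? ys) (n ∈? y ∷ ys))

bounded-on-< : (g : ℕ → ℕ) (n : ℕ) → ∃ λ M → ∀ i → i < n → g i ≤ M
bounded-on-< g zero    = 0 , λ _ ()
bounded-on-< g (suc n) with bounded-on-< g n
... | M , g≤M = M ℕ.⊔ g n , bound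
  where
  bound : ∀ i → i < suc n → g i ≤ M ℕ.⊔ g n
  bound i i<1+n with ℕ.m≤n⇒m<n∨m≡n (ℕ.≤-pred i<1+n)
  ... | inj₁ i<n    = ℕ.m≤n⇒m≤n⊔o (g n) (g≤M i i<n)
  ... | inj₂ ≡.refl = ℕ.m≤n⊔m M (g n)

module Representation where

  open import Data.Nat using (_+_; _*_)
  open import Algebra.Properties.CommutativeSemigroup ℕ.+-commutativeSemigroup using (interchange)

  ∑ℕ-cong : ∀ k {f g : Fin k → ℕ} → (∀ i → f i ≡ g i) → ∑ℕ k f ≡ ∑ℕ k g
  ∑ℕ-cong zero    f≡g = ≡.refl
  ∑ℕ-cong (suc k) f≡g = ≡.cong₂ _+_ (f≡g Fin.zero) (∑ℕ-cong k (f≡g ∘ Fin.suc))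

  ∑ℕ-0 : ∀ k → ∑ℕ k (λ _ → 0) ≡ 0
  ∑ℕ-0 zero    = ≡.refl
  ∑ℕ-0 (suc k) = ∑ℕ-0 k

  ∑ℕ-+ : ∀ k (f g : Fin k → ℕ) → ∑ℕ k (λ i → f i + g i) ≡ ∑ℕ k f + ∑ℕ k g
  ∑ℕ-+ zero    f g = ≡.refl
  ∑ℕ-+ (suc k) f g = ≡.trans (≡.cong (f Fin.zero + g Fin.zero +_) (∑ℕ-+ k (f ∘ Fin.suc) (g ∘ Fin.suc)))
                             (interchange (f Fin.zero) (g Fin.zero) _ _)

  δ : ∀ {k} → Fin k → Fin k → ℕ
  δ Fin.zero    Fin.zero    = 1
  δ Fin.zero    (Fin.suc _) = 0
  δ (Fin.suc _) Fin.zero    = 0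
  δ (Fin.suc j) (Fin.suc i) = δ j i

  ∑ℕ-δ : ∀ {k} (j : Fin k) (a : Fin k → ℕ) → ∑ℕ k (λ i → δ j i * a i) ≡ a j
  ∑ℕ-δ {suc k} Fin.zero    a = ≡.trans (≡.cong₂ _+_ (ℕ.*-identityˡ (a Fin.zero)) (∑ℕ-0 k)) (ℕ.+-identityʳ _)
  ∑ℕ-δ         (Fin.suc j) a = ∑ℕ-δ j (a ∘ Fin.suc)

  Representable : (k : ℕ) → (Fin k → ℕ) → ℕ → Set
  Representable k a n = ∃ λ (x : Fin k → ℕ) → n ≡ ∑ℕ k (λ i → x i * a i)

  module _ {k : ℕ} (a : Fin k → ℕ) where

    representable-0 : Representable k a 0
    representable-0 = (λ _ → 0) , ≡.sym (∑ℕ-0 k)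

    representable-+ : ∀ {m n} → Representable k a m → Representable k a n → Representable k a (m + n)
    representable-+ (x , ≡.refl) (y , ≡.refl) = (λ i → x i + y i) , ≡.sym (≡.trans
      (∑ℕ-cong k (λ i → ℕ.*-distribʳ-+ (a i) (x i) (y i))) (∑ℕ-+ k _ _))

    representable-generator : ∀ j → Representable k a (a j)
    representable-generator j = δ j , ≡.sym (∑ℕ-δ j a)

    representable-* : ∀ q {n} → Representable k a n → Representable k a (q * n)
    representable-* zero    _  = representable-0
    representable-* (suc q) rn = representable-+ rn (representable-* q rn)

    InR-+ : ∀ {m n} → InR k a m → Representable k a n → InR k a (m + n)
    InR-+ {m} {n} (0<m , rm) rn = ℕ.<-≤-trans 0<m (ℕ.m≤m+n m n) , representable-+ rm rn

open Representation

module Gaps (k : ℕ) (a : Fin k → ℕ) (j : Fin k) (a₁>0 : 0 < a j)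
  (m : ℕ → ℕ) (m0≡0 : m 0 ≡ 0)
  (m-least : ∀ i → 1 ≤ i → i < a j →
    InR k a (m i) × CongMod (m i) i (a j) × (∀ n → InR k a n → CongMod n i (a j) → m i ℕ.≤ n))
  where

  a₁ : ℕ
  a₁ = a j

  open import Data.Nat using (_+_; _*_; _∸_)

  instance
    a₁≢0 : NonZero a₁
    a₁≢0 = ℕ.>-nonZero a₁>0

  multiple-representable : ∀ q → Representable k a (q * a₁)
  multiple-representable q = representable-* a q (representable-generator a j)

  gap-class : ∀ i → i < a₁ → ∃ λ T → T * a₁ + i ≡ m i × (∀ q → InNR k a (q * a₁ + i) ⇔ q < T)
  gap-class zero _ = 0 , ≡.sym m0≡0 , λ q → mk⇔
    (λ (0<n , ¬R) → ⊥-elim (¬R (0<n , ≡.subst (Representable k a) (≡.sym (ℕ.+-identityʳ _)) (multiple-representable q))))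
    (λ ())
  gap-class i@(suc _) i<a₁ with m-least i (s≤s z≤n) i<a₁
  ... | mi∈R , (T , mi≡i+Ta₁) , m-min = T , Ta₁+i≡mi , λ q → mk⇔ (below-T q) (gap q)
    where
    Ta₁+i≡mi : T * a₁ + i ≡ m i
    Ta₁+i≡mi = ≡.trans (ℕ.+-comm (T * a₁) i) (≡.sym mi≡i+Ta₁)

    shift : ∀ q → T ≤ q → q * a₁ + i ≡ m i + (q ∸ T) * a₁
    shift q T≤q = begin
      q * a₁ + i                    ≡⟨ ≡.cong (λ t → t * a₁ + i) (ℕ.m+[n∸m]≡n T≤q) ⟨
      (T + (q ∸ T)) * a₁ + i        ≡⟨ regroup T (q ∸ T) a₁ i ⟩
      (T * a₁ + i) + (q ∸ T) * a₁   ≡⟨ ≡.cong (_+ (q ∸ T) * a₁) Ta₁+i≡mi ⟩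
      m i + (q ∸ T) * a₁            ∎
      where
      open ≡.≡-Reasoning
      regroup : ∀ T d a i → (T + d) * a + i ≡ (T * a + i) + d * a
      regroup = solve-∀

    below-T : ∀ q → InNR k a (q * a₁ + i) → q < T
    below-T q (_ , ¬R) = ℕ.≰⇒> λ T≤q →
      ¬R (≡.subst (InR k a) (≡.sym (shift q T≤q)) (InR-+ a mi∈R (multiple-representable (q ∸ T))))

    gap : ∀ q → q < T → InNR k a (q * a₁ + i)
    gap q q<T = ℕ.<-≤-trans (s≤s z≤n) (ℕ.m≤n+m i (q * a₁)) ,
      λ R → ℕ.<⇒≱ (≡.subst (q * a₁ + i <_) Ta₁+i≡mi (ℕ.+-monoˡ-< i (ℕ.*-monoˡ-< a₁ q<T)))
                  (m-min _ R (q , ℕ.+-comm (q * a₁) i))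

  gap<m : ∀ n → InNR k a n → n < m (n % a₁)
  gap<m n n∈NR with gap-class (n % a₁) (m%n<n n a₁)
  ... | T , Ta₁+i≡mi , gap⇔ = ≡.subst₂ _<_ (≡.sym n≡qa₁+i) Ta₁+i≡mi
    (ℕ.+-monoˡ-< (n % a₁) (ℕ.*-monoˡ-< a₁ (Equivalence.to (gap⇔ (n / a₁)) (≡.subst (InNR k a) n≡qa₁+i n∈NR))))
    where
    n≡qa₁+i : n ≡ n / a₁ * a₁ + n % a₁
    n≡qa₁+i = ≡.trans (m≡m%n+[m/n]*n n a₁) (ℕ.+-comm (n % a₁) _)

module PowerSquareSums {r₁ r₂} (R : CommutativeRing r₁ r₂) (λ' u : CommutativeRing.Carrier R) (a : ℕ) where

  open CommutativeRing R
  open RingOps R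
  open RingOpsProperties R
  open FiniteSums R using (∑<-*ʳ; ∑<-telescope)
  open IntegerCoefficientSolver R using (solve; _:=_; _:+_; _:*_; _:-_; con)
  open import Data.Integer using (+_)
  open import Relation.Binary.Reasoning.Setoid setoid

  C₁ C₀ : Carrier
  C₁ = ι 2 * ι a * pow λ' a * (u * u)
  C₀ = ι a * ι a * pow λ' a * (pow λ' a + 1#) * (u * u * u)

  -- The first three terms of the theorem, with its three sums over i < a₁ replaced by s₂, s₁, s₀.
  G : Carrier → Carrier → Carrier → Carrier
  G s₂ s₁ s₀ = u * s₂ - C₁ * s₁ + C₀ * s₀

  F : ℕ → Carrier
  F n = G (ι n * ι n * pow λ' n) (ι n * pow λ' n) (pow λ' n)

  -- Built from λⁿ((n(λ − 1) − λ)² + λ), λⁿ(n(λ − 1) − λ) and λⁿ, which are, up to constants,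
  -- (λ − 1)ʲ⁺¹ ∑_{i<n} iʲλⁱ for j = 2, 1, 0; hence (λ − 1)³ ∑_{i<n} F(i) = Φ(n) − Φ(0).
  Φ : ℕ → Carrier
  Φ n = G (pow λ' n * (e * e + λ')) (y * (pow λ' n * e)) (y * y * pow λ' n)
    where y = λ' - 1#; e = ι n * y - λ'

  G-cong : ∀ {s₂ s₁ s₀ t₂ t₁ t₀} → s₂ ≈ t₂ → s₁ ≈ t₁ → s₀ ≈ t₀ → G s₂ s₁ s₀ ≈ G t₂ t₁ t₀
  G-cong s₂≈ s₁≈ s₀≈ = +-cong (+-cong (*-congˡ s₂≈) (-‿cong (*-congˡ s₁≈))) (*-congˡ s₀≈)

  G-0 : G 0# 0# 0# ≈ 0#
  G-0 = solve 3 (λ u c₁ c₀ → u :* con (+ 0) :- c₁ :* con (+ 0) :+ c₀ :* con (+ 0) := con (+ 0)) refl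
    u C₁ C₀

  G-+ : ∀ s₂ s₁ s₀ t₂ t₁ t₀ → G s₂ s₁ s₀ + G t₂ t₁ t₀ ≈ G (s₂ + t₂) (s₁ + t₁) (s₀ + t₀)
  G-+ = solve 9 (λ u c₁ c₀ s₂ s₁ s₀ t₂ t₁ t₀ →
      (u :* s₂ :- c₁ :* s₁ :+ c₀ :* s₀) :+ (u :* t₂ :- c₁ :* t₁ :+ c₀ :* t₀)
    := u :* (s₂ :+ t₂) :- c₁ :* (s₁ :+ t₁) :+ c₀ :* (s₀ :+ t₀)) refl
    u C₁ C₀

  G-- : ∀ s₂ s₁ s₀ t₂ t₁ t₀ → G s₂ s₁ s₀ - G t₂ t₁ t₀ ≈ G (s₂ - t₂) (s₁ - t₁) (s₀ - t₀)
  G-- = solve 9 (λ u c₁ c₀ s₂ s₁ s₀ t₂ t₁ t₀ →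
      (u :* s₂ :- c₁ :* s₁ :+ c₀ :* s₀) :- (u :* t₂ :- c₁ :* t₁ :+ c₀ :* t₀)
    := u :* (s₂ :- t₂) :- c₁ :* (s₁ :- t₁) :+ c₀ :* (s₀ :- t₀)) refl
    u C₁ C₀

  ∑<-G : ∀ n (s₂ s₁ s₀ : ℕ → Carrier) → ∑< n (λ i → G (s₂ i) (s₁ i) (s₀ i)) ≈ G (∑< n s₂) (∑< n s₁) (∑< n s₀)
  ∑<-G zero    s₂ s₁ s₀ = sym G-0
  ∑<-G (suc n) s₂ s₁ s₀ = trans (+-congʳ (∑<-G n s₂ s₁ s₀)) (G-+ _ _ _ _ _ _)

  Φ-suc : ∀ n → Φ (suc n) - Φ n ≈ F n * ((λ' - 1#) * (λ' - 1#) * (λ' - 1#))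
  Φ-suc n = solve 6 (λ u c₁ c₀ x N p →
      let y = x :- con (+ 1); e = N :* y :- x; e' = (con (+ 1) :+ N) :* y :- x in
      (u :* ((x :* p) :* (e' :* e' :+ x)) :- c₁ :* (y :* ((x :* p) :* e')) :+ c₀ :* (y :* y :* (x :* p)))
        :- (u :* (p :* (e :* e :+ x)) :- c₁ :* (y :* (p :* e)) :+ c₀ :* (y :* y :* p))
      := (u :* (N :* N :* p) :- c₁ :* (N :* p) :+ c₀ :* p) :* (y :* y :* y))
    refl u C₁ C₀ λ' (ι n) (pow λ' n)

  module _ (u[λᵃ-1]≈1 : u * (pow λ' a - 1#) ≈ 1#) where

    -- G is cubic in u = c⁻¹, so clearing the denominator c³ leaves a polynomial identity.
    G-eval : ∀ s₂ s₁ s₀ z → let c = pow λ' a - 1# in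
      s₂ * (c * c) - (1# + 1#) * ι a * pow λ' a * s₁ * c + ι a * ι a * pow λ' a * (pow λ' a + 1#) * s₀
        ≈ z * (c * c * c) →
      G s₂ s₁ s₀ ≈ z
    G-eval s₂ s₁ s₀ z cleared = begin
      G s₂ s₁ s₀                      ≈⟨ x≈y+z[v-1]⇒x≈y u[λᵃ-1]≈1 (expand u c (ι 2) (ι a) (pow λ' a) s₂ s₁ s₀) ⟩
      (u * u * u) * H (ι 2)           ≈⟨ *-congˡ (+-congʳ (+-congˡ (-‿cong (*-congʳ (*-congʳ (*-congʳ (*-congʳ ι-2))))))) ⟩
      (u * u * u) * H (1# + 1#)       ≈⟨ *-congˡ cleared ⟩
      (u * u * u) * (z * (c * c * c)) ≈⟨ inverse-cube u[λᵃ-1]≈1 z ⟩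
      z                               ∎
      where
      c = pow λ' a - 1#
      H : Carrier → Carrier
      H t = s₂ * (c * c) - t * ι a * pow λ' a * s₁ * c + ι a * ι a * pow λ' a * (pow λ' a + 1#) * s₀
      expand : ∀ u c t A L s₂ s₁ s₀ →
        u * s₂ - t * A * L * (u * u) * s₁ + A * A * L * (L + 1#) * (u * u * u) * s₀
        ≈ (u * u * u) * (s₂ * (c * c) - t * A * L * s₁ * c + A * A * L * (L + 1#) * s₀)
          + (t * A * L * (u * u) * s₁ - u * s₂ * (1# + u * c)) * (u * c - 1#)
      expand = solve 8 (λ u c t A L s₂ s₁ s₀ →
          u :* s₂ :- t :* A :* L :* (u :* u) :* s₁ :+ A :* A :* L :* (L :+ con (+ 1)) :* (u :* u :* u) :* s₀
        := (u :* u :* u) :* (s₂ :* (c :* c) :- t :* A :* L :* s₁ :* c :+ A :* A :* L :* (L :+ con (+ 1)) :* s₀)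
          :+ (t :* A :* L :* (u :* u) :* s₁ :- u :* s₂ :* (con (+ 1) :+ u :* c)) :* (u :* c :- con (+ 1))) refl

    F-+a : ∀ n → F (n ℕ.+ a) - F n ≈ pow λ' n * (ι n * ι n)
    F-+a n = begin
      F (n ℕ.+ a) - F n
        ≈⟨ +-congʳ (G-cong (*-cong (*-cong ι-n+a ι-n+a) λⁿ⁺ᵃ) (*-cong ι-n+a λⁿ⁺ᵃ) λⁿ⁺ᵃ) ⟩
      G N'N'p' N'p' p' - G (N * N * p) (N * p) p
        ≈⟨ G-- _ _ _ _ _ _ ⟩
      G (N'N'p' - N * N * p) (N'p' - N * p) (p' - p)
        ≈⟨ G-eval _ _ _ _ (identity N (ι a) p (pow λ' a)) ⟩
      p * (N * N) ∎
      where
      N = ι n ; p = pow λ' n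
      ι-n+a = ι-+ n a ; λⁿ⁺ᵃ = pow-+ λ' n a
      p' = p * pow λ' a
      N'p' = (N + ι a) * p'
      N'N'p' = (N + ι a) * (N + ι a) * p'
      identity : ∀ N A p L → let c = L - 1# in
        ((N + A) * (N + A) * (p * L) - N * N * p) * (c * c)
          - (1# + 1#) * A * L * ((N + A) * (p * L) - N * p) * c
          + A * A * L * (L + 1#) * (p * L - p)
        ≈ p * (N * N) * (c * c * c)
      identity = solve 4 (λ N A p L → let c = L :- con (+ 1) in
          ((N :+ A) :* (N :+ A) :* (p :* L) :- N :* N :* p) :* (c :* c)
            :- con (+ 2) :* A :* L :* ((N :+ A) :* (p :* L) :- N :* p) :* c
            :+ A :* A :* L :* (L :+ con (+ 1)) :* (p :* L :- p)
        := p :* (N :* N) :* (c :* c :* c)) refl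

    Φ-a : Φ a - Φ 0 ≈ λ' * (λ' + 1#)
    Φ-a = trans (G-- _ _ _ _ _ _) (G-eval _ _ _ _ (identity λ' (ι a) (pow λ' a)))
      where
      identity : ∀ x A L → let c = L - 1#; y = x - 1#; e = A * y - x; e₀ = 0# * y - x in
        (L * (e * e + x) - 1# * (e₀ * e₀ + x)) * (c * c)
          - (1# + 1#) * A * L * (y * (L * e) - y * (1# * e₀)) * c
          + A * A * L * (L + 1#) * (y * y * L - y * y * 1#)
        ≈ x * (x + 1#) * (c * c * c)
      identity = solve 3 (λ x A L →
        let c = L :- con (+ 1); y = x :- con (+ 1); e = A :* y :- x; e₀ = con (+ 0) :* y :- x in
          (L :* (e :* e :+ x) :- con (+ 1) :* (e₀ :* e₀ :+ x)) :* (c :* c)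
            :- con (+ 2) :* A :* L :* (y :* (L :* e) :- y :* (con (+ 1) :* e₀)) :* c
            :+ A :* A :* L :* (L :+ con (+ 1)) :* (y :* y :* L :- y :* y :* con (+ 1))
        := x :* (x :+ con (+ 1)) :* (c :* c :* c)) refl

    ∑<-F : ∀ {w} → w * (λ' - 1#) ≈ 1# → ∑< a F ≈ λ' * (λ' + 1#) * (w * w * w)
    ∑<-F {w} w[λ-1]≈1 = begin
      ∑< a F                                        ≈⟨ inverse-cube w[λ-1]≈1 (∑< a F) ⟨
      (w * w * w) * (∑< a F * (y * y * y))          ≈⟨ *-congˡ (∑<-*ʳ a F (y * y * y)) ⟩
      (w * w * w) * ∑< a (λ n → F n * (y * y * y))  ≈⟨ *-congˡ (∑<-telescope Φ _ Φ-suc a) ⟩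
      (w * w * w) * (Φ a - Φ 0)                     ≈⟨ *-congˡ Φ-a ⟩
      (w * w * w) * (λ' * (λ' + 1#))                ≈⟨ *-comm _ _ ⟩
      λ' * (λ' + 1#) * (w * w * w)                  ∎
      where y = λ' - 1#

module GapSums {r₁ r₂} (R : CommutativeRing r₁ r₂) (k : ℕ) (a : Fin k → ℕ) (j : Fin k)
  (a₁>0 : 0 < a j) (m : ℕ → ℕ) (m0≡0 : m 0 ≡ 0)
  (m-least : ∀ i → 1 ≤ i → i < a j →
    InR k a (m i) × CongMod (m i) i (a j) × (∀ n → InR k a n → CongMod n i (a j) → m i ℕ.≤ n))
  (NR : List ℕ) (NR-unique : Unique NR) (NR-gaps : ∀ n → (n ∈ NR) ⇔ InNR k a n)
  where

  open Gaps k a j a₁>0 m m0≡0 m-least using (a₁; a₁≢0; gap-class; gap<m)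

  open CommutativeRing R
  open RingOps R
  open FiniteSums R
  open import Relation.Binary.Reasoning.Setoid setoid

  ∑L-gaps : (F f : ℕ → Carrier) → (∀ n → F (n ℕ.+ a₁) - F n ≈ f n) → ∑L NR f ≈ ∑< a₁ (λ i → F (m i) - F i)
  ∑L-gaps F f F-step = begin
    ∑L NR f                                                                      ≈⟨ ∑L-as-∑< f NR-unique NR<Ka₁ ⟩
    ∑< (K ℕ.* a₁) (λ n → [ n ∈? NR ]· f n)                                       ≈⟨ ∑<-*ℕ K a₁ _ ⟩
    ∑< K (λ q → ∑< a₁ (λ i → [ q ℕ.* a₁ ℕ.+ i ∈? NR ]· f (q ℕ.* a₁ ℕ.+ i)))      ≈⟨ ∑<-comm K a₁ _ ⟩
    ∑< a₁ (λ i → ∑< K (λ q → [ q ℕ.* a₁ ℕ.+ i ∈? NR ]· f (q ℕ.* a₁ ℕ.+ i)))      ≈⟨ ∑<-cong a₁ class-sum ⟩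
    ∑< a₁ (λ i → F (m i) - F i)                                                  ∎
    where
    K : ℕ
    K = proj₁ (bounded-on-< m a₁)

    m≤K : ∀ i → i < a₁ → m i ≤ K
    m≤K = proj₂ (bounded-on-< m a₁)

    NR<Ka₁ : ∀ n → n ∈ NR → n < K ℕ.* a₁
    NR<Ka₁ n n∈NR = ℕ.<-≤-trans (gap<m n (Equivalence.to (NR-gaps n) n∈NR))
                                (≤-trans (m≤K (n % a₁) (m%n<n n a₁)) (ℕ.m≤m*n K a₁))

    class-sum : ∀ i → i < a₁ → ∑< K (λ q → [ q ℕ.* a₁ ℕ.+ i ∈? NR ]· f (q ℕ.* a₁ ℕ.+ i)) ≈ F (m i) - F i
    class-sum i i<a₁ with gap-class i i<a₁
    ... | T , Ta₁+i≡mi , gap⇔ = begin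
      ∑< K (λ q → [ q ℕ.* a₁ ℕ.+ i ∈? NR ]· f (q ℕ.* a₁ ℕ.+ i))
        ≈⟨ ∑<-cong K (λ q _ → []·-⇔ (⇔.trans (NR-gaps _) (gap⇔ q)) (q ℕ.* a₁ ℕ.+ i ∈? NR) (q ℕ.<? T)) ⟩
      ∑< K (λ q → [ q ℕ.<? T ]· f (q ℕ.* a₁ ℕ.+ i))
        ≈⟨ ∑<-[<?]· _ T≤K ⟩
      ∑< T (λ q → f (q ℕ.* a₁ ℕ.+ i))
        ≈⟨ ∑<-telescope (λ q → F (q ℕ.* a₁ ℕ.+ i)) _ step T ⟩
      F (T ℕ.* a₁ ℕ.+ i) - F i
        ≡⟨ ≡.cong (λ n → F n - F i) Ta₁+i≡mi ⟩
      F (m i) - F i ∎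
      where
      T≤K : T ≤ K
      T≤K = ≤-trans (ℕ.m≤m*n T a₁) (≤-trans (ℕ.m≤m+n (T ℕ.* a₁) i) (≡.subst (_≤ K) (≡.sym Ta₁+i≡mi) (m≤K i i<a₁)))

      step : ∀ q → F (suc q ℕ.* a₁ ℕ.+ i) - F (q ℕ.* a₁ ℕ.+ i) ≈ f (q ℕ.* a₁ ℕ.+ i)
      step q = trans (reflexive (≡.cong (λ n → F n - F (q ℕ.* a₁ ℕ.+ i)) reorder)) (F-step (q ℕ.* a₁ ℕ.+ i))
        where
        reorder : a₁ ℕ.+ q ℕ.* a₁ ℕ.+ i ≡ q ℕ.* a₁ ℕ.+ i ℕ.+ a₁
        reorder = ≡.trans (ℕ.+-assoc a₁ _ i) (ℕ.+-comm a₁ _)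

theorem2 : ∀ {c ℓ} (R : CommutativeRing c ℓ) →
    let open CommutativeRing R in
    let open RingOps R in
    IsField → CharZero →
    (k : ℕ) (k≥2 : 2 ≤ k) (a : Fin k → ℕ) → (∀ i → 0 < a i) → gcdAll k a ≡ 1 →
    let a₁ = a (Fin.fromℕ< (≤-trans (s≤s z≤n) k≥2)) in
    (m : ℕ → ℕ) → m 0 ≡ 0 →
    (∀ i → 1 ≤ i → i < a₁ →
      InR k a (m i) × CongMod (m i) i a₁ × (∀ n → InR k a n → CongMod n i a₁ → m i ℕ.≤ n)) →
    (NR : List ℕ) → Unique NR → (∀ n → (n ∈ NR) ⇔ InNR k a n) →
    (λ' : Carrier) → ¬ (λ' ≈ 0#) → ¬ (pow λ' a₁ ≈ 1#) →
    (u w : Carrier) → u * (pow λ' a₁ - 1#) ≈ 1# → w * (λ' - 1#) ≈ 1# →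
    ∑L NR (λ n → pow λ' n * (ι n * ι n))
      ≈ u * ∑< a₁ (λ i → ι (m i) * ι (m i) * pow λ' (m i))
        - ι 2 * ι a₁ * pow λ' a₁ * (u * u) * ∑< a₁ (λ i → ι (m i) * pow λ' (m i))
        + ι a₁ * ι a₁ * pow λ' a₁ * (pow λ' a₁ + 1#) * (u * u * u) * ∑< a₁ (λ i → pow λ' (m i))
        - λ' * (λ' + 1#) * (w * w * w)
theorem2 R _ _ k k≥2 a a>0 _ m m0≡0 m-least NR NR-unique NR-gaps λ' _ _ u w u[λᵃ-1]≈1 w[λ-1]≈1 = begin
  ∑L NR (λ n → pow λ' n * (ι n * ι n))
    ≈⟨ ∑L-gaps F _ (F-+a u[λᵃ-1]≈1) ⟩
  ∑< (a j) (λ i → F (m i) - F i)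
    ≈⟨ ∑<-- (a j) (F ∘ m) F ⟩
  ∑< (a j) (F ∘ m) - ∑< (a j) F
    ≈⟨ +-cong (∑<-G (a j) _ _ _) (-‿cong (∑<-F u[λᵃ-1]≈1 w[λ-1]≈1)) ⟩
  G (∑< (a j) (λ i → ι (m i) * ι (m i) * pow λ' (m i))) (∑< (a j) (λ i → ι (m i) * pow λ' (m i)))
    (∑< (a j) (λ i → pow λ' (m i))) - λ' * (λ' + 1#) * (w * w * w) ∎
  where
  open CommutativeRing R
  open RingOps R
  open FiniteSums R using (∑<--)
  open import Relation.Binary.Reasoning.Setoid setoid

  j : Fin k
  j = Fin.fromℕ< (≤-trans (s≤s z≤n) k≥2)

  open GapSums R k a j (a>0 j) m m0≡0 m-least NR NR-unique NR-gaps using (∑L-gaps)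
  open PowerSquareSums R λ' u (a j) using (G; F; F-+a; ∑<-G; ∑<-F)
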